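{- Let $q>r\geq 1$ and $N\geq 1$ be integers. (1) For all $0\leq t<r$: $f_{q,r}(N)\geq f_{q-t,r-t}(N)$ and $g_{q,r}(N)\geq g_{q-t,r-t}(N)$. (2) For every $d$ dividing $\gcd(q,r)$: $f_{q,r}(N)\geq f_{q/d,r/d}(N)$ and $g_{q,r}(N)\geq g_{q/d,r/d}(N)$. (3) If $p=\lfloor q/(q-r)\rfloor\geq 2$, then $f_{q,r}(N)\geq f_{p,p-1}(N)$ and $g_{q,r}(N)\geq g_{p,p-1}(N)$.
   Context: Path length is the number of vertices. For a $q$-edge-colored complete graph $K$ with a linear order on its vertices, $f_{q,r}(K)$ is the maximum length of a monotone path (vertices increasing in traversal order) whose edges use at most $r$ colors, and $f_{q,r}(N)$ is the minimum of $f_{q,r}(K)$ over all such $K$ on $N$ vertices. For a $q$-edge-colored tournament $T$, $g_{q,r}(T)$ is the maximum length of a directed path in $T$ whose edges use at most $r$ colors, and $g_{q,r}(N)$ is the minimum of $g_{q,r}(T)$ over all $q$-edge-colored $N$-vertex tournaments $T$. -}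

module Defs where

open import Data.Nat using (ℕ; zero; suc; _≤_; _<_; _∸_; NonZero; >-nonZero)
open import Data.Nat.DivMod using (_/_)
open import Data.Nat.Properties using (m<n⇒0<n∸m)
open import Data.Bool using (Bool; true; false)
open import Data.Fin using (Fin)
import Data.Fin as F
open import Data.Fin.Subset using (Subset; _∈_; ∣_∣)
open import Data.List using (List; length)
open import Data.List.Relation.Unary.Linked using (Linked)
open import Data.List.Relation.Unary.Unique.Propositional using (Unique)
open import Data.Product using (Σ; _×_; ∃)
open import Data.Sum using (_⊎_)
open import Relation.Binary.PropositionalEquality using (_≡_; _≢_)

-- An edge colouring with q colours of the complete graph on vertex set Fin N.
-- The colour of the edge {u,v} is read as c u v for u < v (only such pairs are
-- ever consulted for monotone paths); the linear order is the standard order on Fin N.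
EdgeColouring : ℕ → ℕ → Set
EdgeColouring q N = Fin N → Fin N → Fin q

MonoPathR : ∀ {q N} → ℕ → EdgeColouring q N → List (Fin N) → Set
MonoPathR {q} r c vs =
  Σ (Subset q) λ S → ∣ S ∣ ≤ r × Linked (λ u v → u F.< v × c u v ∈ S) vs

fK≡ : ∀ {q N} → ℕ → EdgeColouring q N → ℕ → Set
fK≡ r c m =
  (Σ _ λ vs → MonoPathR r c vs × length vs ≡ m)
  × (∀ vs → MonoPathR r c vs → length vs ≤ m)

f≡ : ℕ → ℕ → ℕ → ℕ → Set
f≡ q r N m =
  (Σ (EdgeColouring q N) λ c → fK≡ r c m)
  × (∀ (c : EdgeColouring q N) m' → fK≡ r c m' → m ≤ m')

record Tournament (N : ℕ) : Set where
  field
    arc     : Fin N → Fin N → Bool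
    total   : ∀ i j → i ≢ j → arc i j ≡ true ⊎ arc j i ≡ true
    antisym : ∀ i j → arc i j ≡ true → arc j i ≡ false

ArcColouring : ℕ → ℕ → Set
ArcColouring q N = Fin N → Fin N → Fin q

DirPathR : ∀ {q N} → ℕ → Tournament N → ArcColouring q N → List (Fin N) → Set
DirPathR {q} r T c vs =
  Unique vs ×
  (Σ (Subset q) λ S → ∣ S ∣ ≤ r
     × Linked (λ u v → Tournament.arc T u v ≡ true × c u v ∈ S) vs)

gT≡ : ∀ {q N} → ℕ → Tournament N → ArcColouring q N → ℕ → Set
gT≡ r T c m =
  (Σ _ λ vs → DirPathR r T c vs × length vs ≡ m)
  × (∀ vs → DirPathR r T c vs → length vs ≤ m)

g≡ : ℕ → ℕ → ℕ → ℕ → Set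
g≡ q r N m =
  (Σ (Tournament N) λ T → Σ (ArcColouring q N) λ c → gT≡ r T c m)
  × (∀ (T : Tournament N) (c : ArcColouring q N) m' → gT≡ r T c m' → m ≤ m')

pOf : (q r : ℕ) → r < q → ℕ
pOf q r r<q = _/_ q (q ∸ r) {{>-nonZero (m<n⇒0<n∸m r<q)}}

{-# OPTIONS --safe #-}
-- Every inequality comes from a colour map φ : [q] → [q'] under which the
-- preimage of any r' colours has at most r elements.  Recolouring a
-- q-colouring c by φ turns every path using at most r' colours of φ ∘ c into a
-- path using at most r colours of c, so f_{q',r'}(N) ≤ f_{q',r'}(φ ∘ c) ≤
-- f_{q,r}(c), and likewise for g.  For (1) φ merges t + 1 colours into one,
-- for (2) it merges the colours in blocks of d, and for (3), with s = q - r,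
-- it cuts the colours into p - 1 blocks of size s and one block of size ≥ s.
module Submission where

open import Defs
open import Data.Nat using (ℕ; zero; suc; _+_; _*_; _∸_; _/_; _≤_; _<_; _≤?_; z≤n; s≤s; NonZero; >-nonZero)
open import Data.Nat.Properties
open import Data.Nat.Divisibility using (_∣_; ∣-trans)
open import Data.Nat.GCD using (gcd; gcd[m,n]∣m; gcd[m,n]∣n)
open import Data.Nat.DivMod using (m/n*n≡m; m/n*n≤m)
open import Data.Fin using (Fin)
import Data.Fin as F
open import Data.Fin.Subset using (Subset; ∣_∣; inside; outside; ⊥) renaming (_∈_ to _∈ₛ_)
open import Data.Fin.Subset.Properties using (∣⊥∣≡0)
open import Data.Vec using ([]; _∷_; tabulate; lookup)
open import Data.Vec.Properties using (lookup∘tabulate; []=⇒lookup; lookup⇒[]=)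
open import Data.List using (List; []; length)
open import Data.List.Relation.Unary.Linked as Linked using (Linked)
open import Data.List.Relation.Unary.AllPairs using (AllPairs)
open import Data.Product using (Σ; ∃; _×_; _,_)
open import Relation.Nullary.Decidable using (decidable-stable; ¬¬-excluded-middle; yes; no)
open import Relation.Nullary.Negation using (¬_; ¬¬-map; contradiction)
open import Relation.Unary using (_⊆_)
open import Relation.Binary.PropositionalEquality

private
  variable
    q q' r r' N a : ℕ

¬¬-greatest : ∀ {n} (Q : ℕ → Set) → Q 0 → (∀ k → Q k → k ≤ n) →
  ¬ ¬ (∃ λ m → Q m × ∀ k → Q k → k ≤ m)
¬¬-greatest {zero} Q q₀ bound = contradiction (0 , q₀ , bound)
¬¬-greatest {suc n} Q q₀ bound ¬greatest = ¬¬-excluded-middle λ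
  { (yes qₙ) → ¬greatest (suc n , qₙ , bound)
  ; (no ¬qₙ) → ¬¬-greatest Q q₀ (bound′ ¬qₙ) ¬greatest
  }
  where
  bound′ : ¬ Q (suc n) → ∀ k → Q k → k ≤ n
  bound′ ¬qₙ k qₖ = ≤-pred (≤∧≢⇒< (bound k qₖ) λ { refl → ¬qₙ qₖ })

module _ {A : Set} where

  -- fK≡ r c and gT≡ r T c are MaxLength (MonoPathR r c) and MaxLength (DirPathR r T c).
  MaxLength : (List A → Set) → ℕ → Set
  MaxLength P m = (Σ (List A) λ vs → P vs × length vs ≡ m) × (∀ vs → P vs → length vs ≤ m)

  ¬¬-maxLength-⊆ : ∀ {P Q : List A → Set} → Q [] → Q ⊆ P → MaxLength P a →
    ¬ ¬ (∃ λ m → MaxLength Q m × m ≤ a)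
  ¬¬-maxLength-⊆ {a = a} {P} {Q} q[] Q⊆P (_ , boundP) =
    ¬¬-map fromGreatest (¬¬-greatest HasLength ([] , q[] , refl) λ { _ (vs , qvs , refl) → boundQ vs qvs })
    where
    HasLength : ℕ → Set
    HasLength k = Σ (List A) λ vs → Q vs × length vs ≡ k
    boundQ : ∀ vs → Q vs → length vs ≤ a
    boundQ vs qvs = boundP vs (Q⊆P qvs)
    fromGreatest : (∃ λ m → HasLength m × ∀ k → HasLength k → k ≤ m) → ∃ λ m → MaxLength Q m × m ≤ a
    fromGreatest (m , witness@(vs , qvs , refl) , greatest) =
      m , (witness , λ ws qws → greatest _ (ws , qws , refl)) , boundQ vs qvs

preimage : (Fin q → Fin q') → Subset q' → Subset q
preimage φ S = tabulate λ i → lookup S (φ i)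

∈-preimage : (φ : Fin q → Fin q') (S : Subset q') {i : Fin q} → φ i ∈ₛ S → i ∈ₛ preimage φ S
∈-preimage φ S {i} φi∈S = lookup⇒[]= i _ (trans (lookup∘tabulate _ i) ([]=⇒lookup φi∈S))

PreimageBounded : (Fin q → Fin q') → ℕ → ℕ → Set
PreimageBounded {q' = q'} φ r r' = (S : Subset q') → ∣ S ∣ ≤ r' → ∣ preimage φ S ∣ ≤ r

recolour : (Fin q → Fin q') → (Fin N → Fin N → Fin q) → Fin N → Fin N → Fin q'
recolour φ c u v = φ (c u v)

-- MonoPathR r c is ColourBoundedWalk r F._<_ c; DirPathR adds Unique to ColourBoundedWalk.
ColourBoundedWalk : ℕ → (Fin N → Fin N → Set) → (Fin N → Fin N → Fin q) → List (Fin N) → Set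
ColourBoundedWalk {q = q} r R c vs = Σ (Subset q) λ S → ∣ S ∣ ≤ r × Linked (λ u v → R u v × c u v ∈ₛ S) vs

emptyWalk : ∀ {R : Fin N → Fin N → Set} (c : Fin N → Fin N → Fin q) → ColourBoundedWalk r R c []
emptyWalk {q = q} c = ⊥ , ≤-trans (≤-reflexive (∣⊥∣≡0 q)) z≤n , Linked.[]

walk-recolour : ∀ {φ : Fin q → Fin q'} {R : Fin N → Fin N → Set} {c} → PreimageBounded φ r r' →
  ColourBoundedWalk r' R (recolour φ c) ⊆ ColourBoundedWalk r R c
walk-recolour {φ = φ} bounded (S , ∣S∣≤r' , links) =
  preimage φ S , bounded S ∣S∣≤r' , Linked.map (λ { (uRv , φc∈S) → uRv , ∈-preimage φ S φc∈S }) links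

Dominates : ℕ → ℕ → ℕ → ℕ → ℕ → Set
Dominates N q r q' r' =
    (∀ a b → f≡ q r N a → f≡ q' r' N b → b ≤ a)
  × (∀ a b → g≡ q r N a → g≡ q' r' N b → b ≤ a)

-- The maximum for the recoloured instance exists only classically, which is
-- enough because b ≤ a is decidable.
dominates : (φ : Fin q → Fin q') → PreimageBounded φ r r' → Dominates N q r q' r'
dominates φ bounded = f-dominates , g-dominates
  where
  f-dominates : ∀ a b → f≡ _ _ _ a → f≡ _ _ _ b → b ≤ a
  f-dominates a b ((c , maxLength) , _) (_ , minimal) = decidable-stable (b ≤? a) (¬¬-map
    (λ { (m , maxLength′ , m≤a) → ≤-trans (minimal (recolour φ c) m maxLength′) m≤a })
    (¬¬-maxLength-⊆ (emptyWalk _) (walk-recolour bounded) maxLength))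
  g-dominates : ∀ a b → g≡ _ _ _ a → g≡ _ _ _ b → b ≤ a
  g-dominates a b ((T , c , maxLength) , _) (_ , minimal) = decidable-stable (b ≤? a) (¬¬-map
    (λ { (m , maxLength′ , m≤a) → ≤-trans (minimal T (recolour φ c) m maxLength′) m≤a })
    (¬¬-maxLength-⊆ (AllPairs.[] , emptyWalk _)
      (λ { (unique , walk) → unique , walk-recolour bounded walk }) maxLength))

prependBlock : ∀ {n k} m → (Fin n → Fin k) → Fin (m + n) → Fin (suc k)
prependBlock zero    ψ i         = F.suc (ψ i)
prependBlock (suc m) ψ F.zero    = F.zero
prependBlock (suc m) ψ (F.suc i) = prependBlock m ψ i

blocks : ∀ s k → Fin (k * s) → Fin k
blocks s zero    ()
blocks s (suc k) = prependBlock s (blocks s k)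

module _ {n k} (ψ : Fin n → Fin k) (S : Subset k) where

  ∣preimage-prependBlock-outside∣ : ∀ m → ∣ preimage (prependBlock m ψ) (outside ∷ S) ∣ ≡ ∣ preimage ψ S ∣
  ∣preimage-prependBlock-outside∣ zero    = refl
  ∣preimage-prependBlock-outside∣ (suc m) = ∣preimage-prependBlock-outside∣ m

  ∣preimage-prependBlock-inside∣ : ∀ m → ∣ preimage (prependBlock m ψ) (inside ∷ S) ∣ ≡ m + ∣ preimage ψ S ∣
  ∣preimage-prependBlock-inside∣ zero    = refl
  ∣preimage-prependBlock-inside∣ (suc m) = cong suc (∣preimage-prependBlock-inside∣ m)

blocks-preimageBounded : ∀ s k r' → PreimageBounded (blocks s k) (r' * s) r'
blocks-preimageBounded s zero r' [] _ = z≤n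
blocks-preimageBounded s (suc k) r' (outside ∷ S) ∣S∣≤r' =
  ≤-trans (≤-reflexive (∣preimage-prependBlock-outside∣ (blocks s k) S s))
          (blocks-preimageBounded s k r' S ∣S∣≤r')
blocks-preimageBounded s (suc k) (suc r') (inside ∷ S) (s≤s ∣S∣≤r') =
  ≤-trans (≤-reflexive (∣preimage-prependBlock-inside∣ (blocks s k) S s))
          (+-monoʳ-≤ s (blocks-preimageBounded s k r' S ∣S∣≤r'))

prependBlock-blocks-preimageBounded : ∀ {s m} k r' → s ≤ m →
  PreimageBounded (prependBlock m (blocks s k)) (m + r' * s) (suc r')
prependBlock-blocks-preimageBounded {s} {m} k r' s≤m (outside ∷ S) ∣S∣≤r' =
  ≤-trans (≤-reflexive (∣preimage-prependBlock-outside∣ (blocks s k) S m))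
          (≤-trans (blocks-preimageBounded s k (suc r') S ∣S∣≤r') (+-monoˡ-≤ (r' * s) s≤m))
prependBlock-blocks-preimageBounded {s} {m} k r' s≤m (inside ∷ S) (s≤s ∣S∣≤r') =
  ≤-trans (≤-reflexive (∣preimage-prependBlock-inside∣ (blocks s k) S m))
          (+-monoʳ-≤ m (blocks-preimageBounded s k r' S ∣S∣≤r'))

dominates-∸ : ∀ {q r t} N → t < r → r < q → Dominates N q r (q ∸ t) (r ∸ t)
dominates-∸ {q} {r} {t} N t<r r<q =
  subst₂ (λ q₀ r₀ → Dominates N q₀ r₀ (q ∸ t) (r ∸ t)) (split t<q) (split t<r)
    (subst₂ (Dominates N _ _) (sym (+-∸-assoc 1 t<q)) (sym (+-∸-assoc 1 t<r))
      (dominates (prependBlock (suc t) (blocks 1 (q ∸ suc t)))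
        (prependBlock-blocks-preimageBounded (q ∸ suc t) (r ∸ suc t) (s≤s z≤n))))
  where
  t<q : t < q
  t<q = <-trans t<r r<q
  split : ∀ {n} → t < n → suc t + (n ∸ suc t) * 1 ≡ n
  split {n} t<n = trans (cong (suc t +_) (*-identityʳ (n ∸ suc t))) (m+[n∸m]≡n t<n)

dominates-/ : ∀ {q r} N d .{{_ : NonZero d}} → d ∣ q → d ∣ r → Dominates N q r (q / d) (r / d)
dominates-/ {q} {r} N d d∣q d∣r =
  subst₂ (λ q₀ r₀ → Dominates N q₀ r₀ (q / d) (r / d)) (m/n*n≡m d∣q) (m/n*n≡m d∣r)
    (dominates (blocks d (q / d)) (blocks-preimageBounded d (q / d) (r / d)))

-- One block of size m = q - (p - 1) s ≥ s and p - 1 blocks of size s = q - r.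
dominates-blocks : ∀ {q r} N p → r ≤ q → 2 ≤ p → p * (q ∸ r) ≤ q → Dominates N q r p (p ∸ 1)
dominates-blocks {q} {r} N (suc (suc k)) r≤q (s≤s (s≤s z≤n)) ps≤q =
  subst₂ (λ q₀ r₀ → Dominates N q₀ r₀ (suc (suc k)) (suc k)) q≡ r≡
    (dominates (prependBlock m (blocks s (suc k))) (prependBlock-blocks-preimageBounded (suc k) k s≤m))
  where
  s = q ∸ r
  m = q ∸ suc k * s
  s≤m : s ≤ m
  s≤m = m+n≤o⇒m≤o∸n s ps≤q
  q≡ : m + suc k * s ≡ q
  q≡ = m∸n+n≡m (m+n≤o⇒n≤o s ps≤q)
  r≡ : m + k * s ≡ r
  r≡ = begin
    m + k * s              ≡⟨ sym (m+n∸n≡m (m + k * s) s) ⟩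
    m + k * s + s ∸ s      ≡⟨ cong (_∸ s) (trans (+-assoc m (k * s) s) (cong (m +_) (+-comm (k * s) s))) ⟩
    m + suc k * s ∸ s      ≡⟨ cong (_∸ s) q≡ ⟩
    q ∸ s                  ≡⟨ m∸[m∸n]≡n r≤q ⟩
    r                      ∎
    where open ≡-Reasoning

dominates-⌊/⌋ : ∀ {q r} N (r<q : r < q) → 2 ≤ pOf q r r<q →
  Dominates N q r (pOf q r r<q) (pOf q r r<q ∸ 1)
dominates-⌊/⌋ {q} {r} N r<q 2≤p =
  dominates-blocks N (pOf q r r<q) (<⇒≤ r<q) 2≤p (m/n*n≤m q (q ∸ r) {{>-nonZero (m<n⇒0<n∸m r<q)}})

lemma3p8 : (q r N : ℕ) → 1 ≤ r → (r<q : r < q) → 1 ≤ N →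
    ((t : ℕ) → t < r →
        (∀ a b → f≡ q r N a → f≡ (q ∸ t) (r ∸ t) N b → b ≤ a)
      × (∀ a b → g≡ q r N a → g≡ (q ∸ t) (r ∸ t) N b → b ≤ a))
    × ((d : ℕ) .{{_ : NonZero d}} → d ∣ gcd q r →
        (∀ a b → f≡ q r N a → f≡ (q / d) (r / d) N b → b ≤ a)
      × (∀ a b → g≡ q r N a → g≡ (q / d) (r / d) N b → b ≤ a))
    × (2 ≤ pOf q r r<q →
        (∀ a b → f≡ q r N a → f≡ (pOf q r r<q) (pOf q r r<q ∸ 1) N b → b ≤ a)
      × (∀ a b → g≡ q r N a → g≡ (pOf q r r<q) (pOf q r r<q ∸ 1) N b → b ≤ a))
lemma3p8 q r N _ r<q _ =
    (λ t t<r → dominates-∸ N t<r r<q)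
  , (λ d d∣gcd → dominates-/ N d (∣-trans d∣gcd (gcd[m,n]∣m q r)) (∣-trans d∣gcd (gcd[m,n]∣n q r)))
  , dominates-⌊/⌋ N r<q
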